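{- Fix a dynamic filter algorithm $\mathcal{D}$ with universe $U$ and capacity $n$, a fixed random tape, an integer $b$ dividing $n$, and a partition $\pi=(U_1,\ldots,U_b)$ of $U$. Let $F$ and $G$ be filter states arising from executing operation sequences $\sigma_F$ and $\sigma_G$, each conforming to $\pi$, on the initial empty filter. Then: (1) the true key set of $F$ is contained in $\widetilde{A}(F)$, and $\widetilde{A}(F)$ is contained in the accepted set $A(F)$; (2) if $\sigma_G$ is a prefix of $\sigma_F$ such that the remaining part of $\sigma_F$ after $\sigma_G$ is self-contained, and the true key set of $G$ has size $\ell n/b$ for some integer $\ell$, then $\widetilde{A}(G)\subseteq\widetilde{A}(F)$.
   Context: A dynamic filter algorithm maintains, in a fixed-length memory together with a read-only random tape, a true key set $S\subseteq U$ of size at most $n$, starting empty, via Insert($x$) (for $x\notin S$) and Delete($x$) (for $x\in S$), and answers Query($x$), which is true for all $x\in S$. With the random tape fixed, the accepted set $A(F)$ of a filter state $F$ is the set of $x\in U$ on which Query returns true for the memory contents of $F$. A sequence of insertions and deletions is self-contained if each deleted key was inserted earlier in the same sequence and not deleted in between, and between any two insertions of a key there is a deletion of that key. A sequence $\sigma$ conforms to $\pi$ if it is self-contained and, when executed on an initially empty filter, whenever the current true key set has size in $[(k-1)n/b,\,kn/b)$ it only inserts keys from $U_k$, and whenever the size is in $((k-1)n/b,\,kn/b]$ it only deletes keys from $U_k$. For a filter state $F$ arising from a sequence conforming to $\pi$, its reconstructible set $\widetilde{A}(F)$ is the set of keys $x$ for which there is a filter state $F'$, arising from executing some sequence conforming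 to $\pi$ on the initial empty filter (same random tape), such that $F'$ has the same memory representation as $F$, the same true key set size as $F$, and $x$ belongs to the true key set of $F'$. -}

module Defs where

open import Data.Nat using (ℕ; suc; _≤_; _<_; _*_; _/_; NonZero)
open import Data.Fin using (Fin; toℕ)
open import Data.Bool using (Bool; true)
open import Data.Vec using (Vec)
open import Data.List using (List; []; _∷_; length; filter)
open import Data.List.Membership.Propositional using (_∈_; _∉_)
open import Data.Product using (Σ; _×_)
open import Relation.Nullary using (¬?)
open import Relation.Binary.Definitions using (DecidableEquality)
open import Relation.Binary.PropositionalEquality using (_≡_)

data Op (U : Set) : Set where
  ins : U → Op U
  del : U → Op U

-- Fixing the tape makes the
-- algorithm deterministic.
record DynamicFilter (U : Set) (n : ℕ) : Set₁ where
  field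
    w      : ℕ
    Tape   : Set
    init   : Tape → Vec Bool w
    insert : Tape → U → Vec Bool w → Vec Bool w
    delete : Tape → U → Vec Bool w → Vec Bool w
    query  : Tape → U → Vec Bool w → Bool

  execFrom : Tape → Vec Bool w → List (Op U) → Vec Bool w
  execFrom r m []            = m
  execFrom r m (ins x ∷ σ)   = execFrom r (insert r x m) σ
  execFrom r m (del x ∷ σ)   = execFrom r (delete r x m) σ

  mem : Tape → List (Op U) → Vec Bool w
  mem r σ = execFrom r (init r) σ

module Keys {U : Set} (_≟_ : DecidableEquality U) where

  keysFrom : List U → List (Op U) → List U
  keysFrom S []          = S
  keysFrom S (ins x ∷ σ) = keysFrom (x ∷ S) σ
  keysFrom S (del x ∷ σ) = keysFrom (filter (λ y → ¬? (y ≟ x)) S) σ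

  keys : List (Op U) → List U
  keys σ = keysFrom [] σ

  data ValidFrom : List U → List (Op U) → Set where
    []  : ∀ {S} → ValidFrom S []
    ins : ∀ {S x σ} → x ∉ S → ValidFrom (x ∷ S) σ → ValidFrom S (ins x ∷ σ)
    del : ∀ {S x σ} → x ∈ S →
          ValidFrom (filter (λ y → ¬? (y ≟ x)) S) σ → ValidFrom S (del x ∷ σ)

  -- self-contained: every deleted key was inserted earlier and not deleted
  -- in between, and between two insertions of a key there is a deletion of
  -- it; equivalently, σ is valid starting from the empty key set.
  SelfContained : List (Op U) → Set
  SelfContained σ = ValidFrom [] σ

  data WithinCapacityFrom (n : ℕ) : List U → List (Op U) → Set where
    []  : ∀ {S} → WithinCapacityFrom n S []
    ins : ∀ {S x σ} → length (x ∷ S) ≤ n →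
          WithinCapacityFrom n (x ∷ S) σ → WithinCapacityFrom n S (ins x ∷ σ)
    del : ∀ {S x σ} → WithinCapacityFrom n (filter (λ y → ¬? (y ≟ x)) S) σ →
          WithinCapacityFrom n S (del x ∷ σ)

  -- Partition rule, with parts U_k = π⁻¹(k), k ∈ Fin b standing for the
  -- paper's index k = toℕ k + 1, and m = n / b:
  --  size ∈ [(k-1)m, km)  ⇒ inserted key lies in U_k
  --  size ∈ ((k-1)m, km]  ⇒ deleted key lies in U_k
  data RespectsFrom {b : ℕ} (π : U → Fin b) (m : ℕ) : List U → List (Op U) → Set where
    []  : ∀ {S} → RespectsFrom π m S []
    ins : ∀ {S x σ} →
          (∀ (k : Fin b) → toℕ k * m ≤ length S → length S < suc (toℕ k) * m → π x ≡ k) →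
          RespectsFrom π m (x ∷ S) σ → RespectsFrom π m S (ins x ∷ σ)
    del : ∀ {S x σ} →
          (∀ (k : Fin b) → toℕ k * m < length S → length S ≤ suc (toℕ k) * m → π x ≡ k) →
          RespectsFrom π m (filter (λ y → ¬? (y ≟ x)) S) σ → RespectsFrom π m S (del x ∷ σ)

  Conforms : (n b : ℕ) → .{{NonZero b}} → (U → Fin b) → List (Op U) → Set
  Conforms n b π σ =
    SelfContained σ × WithinCapacityFrom n [] σ × RespectsFrom π (n / b) [] σ

  module _ {n : ℕ} (D : DynamicFilter U n) where
    open DynamicFilter D

    NoFalseNegatives : Set
    NoFalseNegatives = ∀ (r : Tape) (σ : List (Op U)) → SelfContained σ →
      WithinCapacityFrom n [] σ → ∀ x → x ∈ keys σ → query r x (mem r σ) ≡ true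

    Accepted : Tape → List (Op U) → U → Set
    Accepted r σ x = query r x (mem r σ) ≡ true

    Reconstructible : Tape → (b : ℕ) → .{{NonZero b}} → (U → Fin b) →
                      List (Op U) → U → Set
    Reconstructible r b π σ x =
      Σ (List (Op U)) λ σ' → Conforms n b π σ' × mem r σ' ≡ mem r σ ×
        length (keys σ') ≡ length (keys σ) × x ∈ keys σ'

-- Let m = n / b be the block size and |keys σG| = ℓm, and call a key low when its part
-- index is below ℓ.  Along a conforming run the key set contains at least ℓm low keys
-- or no high key at all, so a conforming state of size ℓm holds only low keys.  From
-- such a state every insertion happens at size at least ℓm and so inserts a high key;
-- the self-contained τ therefore never touches the keys of σG, nor those of a witness
-- σ' for x ∈ Ã(G).  Hence σ' ++ τ passes through the same sizes as σG ++ τ, conforms,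
-- and witnesses x ∈ Ã(F).
module Submission where

open import Defs
open import Data.Nat using (ℕ; zero; suc; _+_; _*_; _/_; _%_; NonZero; _≤_; _<_; z≤n; s≤s; _<?_)
open import Data.Nat.Properties
open import Data.Nat.DivMod using (m≡m%n+[m/n]*n; m%n<n; m/n*n≤m; m<n*o⇒m/o<n; m*[n/m]≡n)
open import Data.Nat.Divisibility using (_∣_)
open import Data.Fin using (Fin; toℕ; fromℕ<)
open import Data.Fin.Properties using (toℕ-fromℕ<)
open import Data.Bool using (true; false)
open import Data.List using (List; []; _∷_; _++_; length; filter)
open import Data.List.Properties
  using ( length-++; length-++-≤ʳ; length-filter
        ; filter-++; filter-all; filter-accept; filter-reject; filter-complete )
open import Data.List.Membership.Propositional using (_∈_; _∉_)
open import Data.List.Membership.Propositional.Properties using (∈-++⁺ˡ; ∈-++⁺ʳ; ∈-++⁻)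
open import Data.List.Relation.Unary.All as All using (All; []; _∷_)
import Data.List.Relation.Unary.All.Properties as All
open import Data.List.Relation.Unary.Any using (here; there)
open import Data.Product using (_×_; _,_)
open import Data.Sum as Sum using (_⊎_; inj₁; inj₂; [_,_]′)
open import Function using (_∘_)
open import Function.Bundles using (_⇔_; mk⇔; Equivalence)
open import Relation.Nullary using (¬_; ¬?; Dec; yes; no; does)
open import Relation.Unary using (Pred; Decidable)
open import Relation.Binary.Definitions using (DecidableEquality)
open import Relation.Binary.PropositionalEquality

m<[1+m/n]*n : ∀ m n .{{_ : NonZero n}} → m < suc (m / n) * n
m<[1+m/n]*n m n = begin-strict
  m                 ≡⟨ m≡m%n+[m/n]*n m n ⟩
  m % n + m / n * n <⟨ +-monoˡ-< (m / n * n) (m%n<n m n) ⟩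
  suc (m / n) * n   ∎
  where open ≤-Reasoning

m/o<n⇒m<n*o : ∀ {m n o} .{{_ : NonZero o}} → m / o < n → m < n * o
m/o<n⇒m<n*o {m} {n} {o} m/o<n = <-≤-trans (m<[1+m/n]*n m o) (*-monoˡ-≤ o m/o<n)

nonZero-of-∈ : ∀ {A : Set} {x : A} {xs : List A} ℓ m →
               x ∈ xs → length xs ≡ ℓ * m → NonZero m
nonZero-of-∈ {xs = _ ∷ _} ℓ zero _ len with () ← trans len (*-zeroʳ ℓ)
nonZero-of-∈ ℓ (suc m) _ _ = _

filter-filter-⊆ : ∀ {a p q} {A : Set a} {P : Pred A p} {Q : Pred A q}
                  (P? : Decidable P) (Q? : Decidable Q) →
                  (∀ {x} → P x → Q x) → ∀ xs → filter P? (filter Q? xs) ≡ filter P? xs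
filter-filter-⊆ P? Q? P⊆Q [] = refl
filter-filter-⊆ P? Q? P⊆Q (x ∷ xs) with ih ← filter-filter-⊆ P? Q? P⊆Q xs | Q? x
... | no ¬qx = trans ih (sym (filter-reject P? (¬qx ∘ P⊆Q)))
... | yes _ with does (P? x)
...   | true  = cong (x ∷_) ih
...   | false = ih

module _ {U : Set} (_≟_ : DecidableEquality U) where
  open Keys _≟_

  remove : U → List U → List U
  remove x = filter (λ y → ¬? (y ≟ x))

  remove-++-∉ : ∀ T {S x} → x ∉ S → remove x (T ++ S) ≡ remove x T ++ S
  remove-++-∉ T {S} {x} x∉S = begin
    remove x (T ++ S)          ≡⟨ filter-++ (λ y → ¬? (y ≟ x)) T S ⟩
    remove x T ++ remove x S   ≡⟨ cong (remove x T ++_) (filter-all (λ y → ¬? (y ≟ x)) S≢x) ⟩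
    remove x T ++ S            ∎
    where
    open ≡-Reasoning
    S≢x : All (λ y → ¬ y ≡ x) S
    S≢x = All.map (_∘ sym) (All.¬Any⇒All¬ S x∉S)

  length-++-≡ : ∀ T {S S' : List U} → length S ≡ length S' → length (T ++ S) ≡ length (T ++ S')
  length-++-≡ T {S} {S'} eq = begin
    length (T ++ S)      ≡⟨ length-++ T ⟩
    length T + length S  ≡⟨ cong (length T +_) eq ⟩
    length T + length S' ≡⟨ length-++ T ⟨
    length (T ++ S')     ∎
    where open ≡-Reasoning

  keysFrom-++ : ∀ S σ τ → keysFrom S (σ ++ τ) ≡ keysFrom (keysFrom S σ) τ
  keysFrom-++ S []          τ = refl
  keysFrom-++ S (ins x ∷ σ) τ = keysFrom-++ (x ∷ S) σ τ
  keysFrom-++ S (del x ∷ σ) τ = keysFrom-++ (remove x S) σ τ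

  ValidFrom-++⁻ : ∀ {S} σ {τ} → ValidFrom S (σ ++ τ) → ValidFrom (keysFrom S σ) τ
  ValidFrom-++⁻ []          v          = v
  ValidFrom-++⁻ (ins x ∷ σ) (ins _ v) = ValidFrom-++⁻ σ v
  ValidFrom-++⁻ (del x ∷ σ) (del _ v) = ValidFrom-++⁻ σ v

  ValidFrom-++⁺ : ∀ {S σ τ} → ValidFrom S σ → ValidFrom (keysFrom S σ) τ →
                  ValidFrom S (σ ++ τ)
  ValidFrom-++⁺ []        v' = v'
  ValidFrom-++⁺ (ins p v) v' = ins p (ValidFrom-++⁺ v v')
  ValidFrom-++⁺ (del p v) v' = del p (ValidFrom-++⁺ v v')

  module _ {n : ℕ} where

    WithinCapacityFrom-++⁻ : ∀ {S} σ {τ} → WithinCapacityFrom n S (σ ++ τ) →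
                             WithinCapacityFrom n (keysFrom S σ) τ
    WithinCapacityFrom-++⁻ []          w         = w
    WithinCapacityFrom-++⁻ (ins x ∷ σ) (ins _ w) = WithinCapacityFrom-++⁻ σ w
    WithinCapacityFrom-++⁻ (del x ∷ σ) (del w)   = WithinCapacityFrom-++⁻ σ w

    WithinCapacityFrom-++⁺ : ∀ {S σ τ} → WithinCapacityFrom n S σ →
                             WithinCapacityFrom n (keysFrom S σ) τ → WithinCapacityFrom n S (σ ++ τ)
    WithinCapacityFrom-++⁺ []        w' = w'
    WithinCapacityFrom-++⁺ (ins c w) w' = ins c (WithinCapacityFrom-++⁺ w w')
    WithinCapacityFrom-++⁺ (del w)   w' = del (WithinCapacityFrom-++⁺ w w')

  module _ {b : ℕ} (π : U → Fin b) (m : ℕ) where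

    InsertionRule : U → ℕ → Set
    InsertionRule x s = ∀ (k : Fin b) → toℕ k * m ≤ s → s < suc (toℕ k) * m → π x ≡ k

    DeletionRule : U → ℕ → Set
    DeletionRule x s = ∀ (k : Fin b) → toℕ k * m < s → s ≤ suc (toℕ k) * m → π x ≡ k

    RespectsFrom-++⁻ : ∀ {S} σ {τ} → RespectsFrom π m S (σ ++ τ) →
                       RespectsFrom π m (keysFrom S σ) τ
    RespectsFrom-++⁻ []          ρ         = ρ
    RespectsFrom-++⁻ (ins x ∷ σ) (ins _ ρ) = RespectsFrom-++⁻ σ ρ
    RespectsFrom-++⁻ (del x ∷ σ) (del _ ρ) = RespectsFrom-++⁻ σ ρ

    RespectsFrom-++⁺ : ∀ {S σ τ} → RespectsFrom π m S σ →
                       RespectsFrom π m (keysFrom S σ) τ → RespectsFrom π m S (σ ++ τ)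
    RespectsFrom-++⁺ []           ρ' = ρ'
    RespectsFrom-++⁺ (ins rule ρ) ρ' = ins rule (RespectsFrom-++⁺ ρ ρ')
    RespectsFrom-++⁺ (del rule ρ) ρ' = del rule (RespectsFrom-++⁺ ρ ρ')

  -- Running τ from T ++ S behaves like running it from T: it never inserts or deletes
  -- a key of S.
  data Avoids (S : List U) : List U → List (Op U) → Set where
    []  : ∀ {T} → Avoids S T []
    ins : ∀ {T x τ} → x ∉ T → x ∉ S → Avoids S (x ∷ T) τ → Avoids S T (ins x ∷ τ)
    del : ∀ {T x τ} → x ∈ T → x ∉ S → Avoids S (remove x T) τ → Avoids S T (del x ∷ τ)

  module _ {S : List U} where

    keysFrom-++-Avoids : ∀ {T τ} → Avoids S T τ → keysFrom (T ++ S) τ ≡ keysFrom T τ ++ S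
    keysFrom-++-Avoids []                        = refl
    keysFrom-++-Avoids (ins _ _ a)               = keysFrom-++-Avoids a
    keysFrom-++-Avoids {T} {del x ∷ τ} (del _ x∉S a) =
      trans (cong (λ R → keysFrom R τ) (remove-++-∉ T x∉S)) (keysFrom-++-Avoids a)

    ValidFrom-++-Avoids : ∀ {T τ} → Avoids S T τ → ValidFrom (T ++ S) τ
    ValidFrom-++-Avoids []                      = []
    ValidFrom-++-Avoids {T} (ins x∉T x∉S a)     =
      ins (λ x∈ → [ x∉T , x∉S ]′ (∈-++⁻ T x∈)) (ValidFrom-++-Avoids a)
    ValidFrom-++-Avoids {T} {del x ∷ τ} (del x∈T x∉S a) =
      del (∈-++⁺ˡ x∈T)
        (subst (λ R → ValidFrom R τ) (sym (remove-++-∉ T x∉S)) (ValidFrom-++-Avoids a))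

  module _ {S S' : List U} (|S|≡|S'| : length S ≡ length S') where

    WithinCapacityFrom-Avoids : ∀ {n T τ} → Avoids S T τ → Avoids S' T τ →
      WithinCapacityFrom n (T ++ S) τ → WithinCapacityFrom n (T ++ S') τ
    WithinCapacityFrom-Avoids []          []           []        = []
    WithinCapacityFrom-Avoids {n} {T} (ins _ _ a) (ins _ _ a') (ins c w) =
      ins (subst (_≤ n) (cong suc (length-++-≡ T |S|≡|S'|)) c) (WithinCapacityFrom-Avoids a a' w)
    WithinCapacityFrom-Avoids {n} {T} {del x ∷ τ} (del _ x∉S a) (del _ x∉S' a') (del w) =
      del (subst (λ R → WithinCapacityFrom n R τ) (sym (remove-++-∉ T x∉S'))
            (WithinCapacityFrom-Avoids a a'
              (subst (λ R → WithinCapacityFrom n R τ) (remove-++-∉ T x∉S) w)))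

    RespectsFrom-Avoids : ∀ {b} {π : U → Fin b} {m T τ} → Avoids S T τ → Avoids S' T τ →
      RespectsFrom π m (T ++ S) τ → RespectsFrom π m (T ++ S') τ
    RespectsFrom-Avoids []          []           []        = []
    RespectsFrom-Avoids {π = π} {m} {T} {ins x ∷ _} (ins _ _ a) (ins _ _ a') (ins rule ρ) =
      ins (subst (InsertionRule π m x) (length-++-≡ T |S|≡|S'|) rule) (RespectsFrom-Avoids a a' ρ)
    RespectsFrom-Avoids {π = π} {m} {T} {del x ∷ τ} (del _ x∉S a) (del _ x∉S' a') (del rule ρ) =
      del (subst (DeletionRule π m x) (length-++-≡ T |S|≡|S'|) rule)
        (subst (λ R → RespectsFrom π m R τ) (sym (remove-++-∉ T x∉S'))
          (RespectsFrom-Avoids a a' (subst (λ R → RespectsFrom π m R τ) (remove-++-∉ T x∉S) ρ)))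

  keys-++-Avoids : ∀ σ {τ} → Avoids (keys σ) [] τ → keys (σ ++ τ) ≡ keys τ ++ keys σ
  keys-++-Avoids σ {τ} avoidsσ = trans (keysFrom-++ [] σ τ) (keysFrom-++-Avoids avoidsσ)

  module _ {n b : ℕ} .{{_ : NonZero b}} {π : U → Fin b} where

    Conforms-++-Avoids : ∀ σ {σ' τ} → length (keys σ) ≡ length (keys σ') →
      Avoids (keys σ) [] τ → Avoids (keys σ') [] τ →
      WithinCapacityFrom n (keys σ) τ → RespectsFrom π (n / b) (keys σ) τ →
      Conforms n b π σ' → Conforms n b π (σ' ++ τ)
    Conforms-++-Avoids _ |σ|≡|σ'| avoids avoids' within respects (valid' , within' , respects') =
        ValidFrom-++⁺ valid' (ValidFrom-++-Avoids avoids')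
      , WithinCapacityFrom-++⁺ within' (WithinCapacityFrom-Avoids |σ|≡|σ'| avoids avoids' within)
      , RespectsFrom-++⁺ π (n / b) respects' (RespectsFrom-Avoids |σ|≡|σ'| avoids avoids' respects)

  module LowKeys {b : ℕ} (π : U → Fin b) (m : ℕ) .{{_ : NonZero m}} (ℓ : ℕ)
                 {n : ℕ} (n≤b*m : n ≤ b * m) where

    blockIndex : ∀ {x s} → InsertionRule π m x s → s < b * m → toℕ (π x) ≡ s / m
    blockIndex {x} {s} rule s<b*m = begin
      toℕ (π x) ≡⟨ cong toℕ (rule k lower upper) ⟩
      toℕ k     ≡⟨ toℕ-fromℕ< s/m<b ⟩
      s / m     ∎
      where
      open ≡-Reasoning
      s/m<b : s / m < b
      s/m<b = m<n*o⇒m/o<n s<b*m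
      k : Fin b
      k = fromℕ< s/m<b
      lower : toℕ k * m ≤ s
      lower = subst (λ j → j * m ≤ s) (sym (toℕ-fromℕ< s/m<b)) (m/n*n≤m s m)
      upper : s < suc (toℕ k) * m
      upper = subst (λ j → s < suc j * m) (sym (toℕ-fromℕ< s/m<b)) (m<[1+m/n]*n s m)

    Low : U → Set
    Low x = toℕ (π x) < ℓ

    Low? : Decidable Low
    Low? x = toℕ (π x) <? ℓ

    High : U → Set
    High x = ¬ Low x

    Low⇔< : ∀ {x s} → InsertionRule π m x s → s < n → Low x ⇔ s < ℓ * m
    Low⇔< rule s<n = mk⇔
      (λ low → m/o<n⇒m<n*o (subst (_< ℓ) index low))
      (λ s<ℓm → subst (_< ℓ) (sym index) (m<n*o⇒m/o<n s<ℓm))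
      where index = blockIndex rule (<-≤-trans s<n n≤b*m)

    inserted-High : ∀ {x s} → ℓ * m ≤ s → s < n → InsertionRule π m x s → High x
    inserted-High ℓm≤s s<n rule low = <⇒≱ (Equivalence.to (Low⇔< rule s<n) low) ℓm≤s

    deleted-Low : ∀ {x s} → s ≤ n → DeletionRule π m x s → Low x → s ≤ ℓ * m
    deleted-Low {s = zero}  _   _    _ = z≤n
    deleted-Low {s = suc s} s≤n rule   = Equivalence.to (Low⇔< (λ k p q → rule k (s≤s p) q) s≤n)

    LowCount : List U → ℕ
    LowCount S = length (filter Low? S)

    -- Invariant along conforming runs: a high key is only inserted at size ≥ ℓm, and a
    -- low key only deleted at size ≤ ℓm.
    LowBound : List U → Set
    LowBound S = ℓ * m ≤ LowCount S ⊎ All Low S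

    All-Low-of-≤ : ∀ {S} → length S ≤ LowCount S → All Low S
    All-Low-of-≤ {S} le =
      subst (All Low) (filter-complete Low? (≤-antisym (length-filter Low? S) le)) (All.all-filter Low? S)

    LowBound⇒≤LowCount : ∀ {S} → ℓ * m ≤ length S → LowBound S → ℓ * m ≤ LowCount S
    LowBound⇒≤LowCount _     (inj₁ le)  = le
    LowBound⇒≤LowCount ℓm≤|S| (inj₂ low) =
      subst (ℓ * m ≤_) (sym (cong length (filter-all Low? low))) ℓm≤|S|

    LowBound-ins : ∀ {x S} → length S < n → InsertionRule π m x (length S) →
                   LowBound S → LowBound (x ∷ S)
    LowBound-ins {x} {S} |S|<n rule bound = by-lowness (Low? x)
      where
      by-lowness : Dec (Low x) → LowBound (x ∷ S)
      by-lowness (no high) = inj₁ (subst (ℓ * m ≤_) (cong length (sym (filter-reject Low? high)))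
        (LowBound⇒≤LowCount (≮⇒≥ (high ∘ Equivalence.from (Low⇔< rule |S|<n))) bound))
      by-lowness (yes low) = Sum.map
        (λ le → subst (ℓ * m ≤_) (cong length (sym (filter-accept Low? low))) (m≤n⇒m≤1+n le))
        (low ∷_) bound

    LowBound-del : ∀ {y S} → length S ≤ n → DeletionRule π m y (length S) →
                   LowBound S → LowBound (remove y S)
    LowBound-del _ _ (inj₂ all) = inj₂ (All.filter⁺ _ all)
    LowBound-del {y} {S} |S|≤n rule (inj₁ le) with Low? y
    ... | yes low =
      inj₂ (All.filter⁺ _ (All-Low-of-≤ {S} (≤-trans (deleted-Low |S|≤n rule low) le)))
    ... | no high = inj₁ (subst (ℓ * m ≤_) (sym (cong length low-unchanged)) le)
      where
      low-unchanged : filter Low? (remove y S) ≡ filter Low? S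
      low-unchanged =
        filter-filter-⊆ Low? (λ z → ¬? (z ≟ y)) (λ low z≡y → high (subst Low z≡y low)) S

    LowBound-keysFrom : ∀ {S σ} → length S ≤ n →
      WithinCapacityFrom n S σ → RespectsFrom π m S σ → LowBound S → LowBound (keysFrom S σ)
    LowBound-keysFrom _ [] [] bound = bound
    LowBound-keysFrom _ (ins c w) (ins rule ρ) bound = LowBound-keysFrom c w ρ (LowBound-ins c rule bound)
    LowBound-keysFrom {S} |S|≤n (del w) (del rule ρ) bound =
      LowBound-keysFrom (≤-trans (length-filter _ S) |S|≤n) w ρ (LowBound-del |S|≤n rule bound)

    keys-All-Low : ∀ {σ} → WithinCapacityFrom n [] σ → RespectsFrom π m [] σ →
                   length (keys σ) ≡ ℓ * m → All Low (keys σ)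
    keys-All-Low w ρ len = All-Low-of-≤ (≤-trans (≤-reflexive len)
      (LowBound⇒≤LowCount (≤-reflexive (sym len)) (LowBound-keysFrom z≤n w ρ (inj₂ []))))

    High∉ : ∀ {x S} → High x → All Low S → x ∉ S
    High∉ high low x∈S = high (All.lookup low x∈S)

    module _ {S : List U} (low : All Low S) where

      inserts-High : ℓ * m ≤ length S → ∀ {T τ} → ValidFrom T τ → All High T →
        WithinCapacityFrom n (T ++ S) τ → RespectsFrom π m (T ++ S) τ →
        ∀ {x} → ins x ∈ τ → High x
      inserts-High ℓm≤|S| {T} (ins _ v) high (ins c w) (ins rule ρ) (here refl) =
        inserted-High (≤-trans ℓm≤|S| (length-++-≤ʳ S {T})) c rule
      inserts-High ℓm≤|S| {T} (ins _ v) high (ins c w) (ins rule ρ) (there p) =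
        inserts-High ℓm≤|S| v
          (inserted-High (≤-trans ℓm≤|S| (length-++-≤ʳ S {T})) c rule ∷ high) w ρ p
      inserts-High ℓm≤|S| {T} {del y ∷ τ} (del y∈T v) high (del w) (del _ ρ) (there p) =
        inserts-High ℓm≤|S| v (All.filter⁺ _ high)
          (subst (λ R → WithinCapacityFrom n R τ) (remove-++-∉ T y∉S) w)
          (subst (λ R → RespectsFrom π m R τ) (remove-++-∉ T y∉S) ρ) p
        where y∉S = High∉ (All.lookup high y∈T) low

      avoids : ∀ {T τ} → ValidFrom T τ → All High T → (∀ {x} → ins x ∈ τ → High x) →
               Avoids S T τ
      avoids []          _    _       = []
      avoids (ins x∉T v) high inserts =
        ins x∉T (High∉ (inserts (here refl)) low)
          (avoids v (inserts (here refl) ∷ high) (inserts ∘ there))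
      avoids (del x∈T v) high inserts =
        del x∈T (High∉ (All.lookup high x∈T) low) (avoids v (All.filter⁺ _ high) (inserts ∘ there))

  module _ {n : ℕ} (D : DynamicFilter U n) where
    open DynamicFilter D

    execFrom-++ : ∀ r M σ τ → execFrom r M (σ ++ τ) ≡ execFrom r (execFrom r M σ) τ
    execFrom-++ r M []          τ = refl
    execFrom-++ r M (ins x ∷ σ) τ = execFrom-++ r (insert r x M) σ τ
    execFrom-++ r M (del x ∷ σ) τ = execFrom-++ r (delete r x M) σ τ

    mem-++-cong : ∀ {r} σ σ' τ → mem r σ ≡ mem r σ' → mem r (σ ++ τ) ≡ mem r (σ' ++ τ)
    mem-++-cong {r} σ σ' τ mem≡ = begin
      mem r (σ ++ τ)          ≡⟨ execFrom-++ r (init r) σ τ ⟩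
      execFrom r (mem r σ) τ  ≡⟨ cong (λ M → execFrom r M τ) mem≡ ⟩
      execFrom r (mem r σ') τ ≡⟨ execFrom-++ r (init r) σ' τ ⟨
      mem r (σ' ++ τ)         ∎
      where open ≡-Reasoning

    module _ (r : Tape) (b : ℕ) .{{_ : NonZero b}} (π : U → Fin b) where

      keys⊆Reconstructible : ∀ {σ} → Conforms n b π σ →
                             ∀ x → x ∈ keys σ → Reconstructible D r b π σ x
      keys⊆Reconstructible {σ} conforms _ x∈ = σ , conforms , refl , refl , x∈

      Reconstructible⊆Accepted : NoFalseNegatives D →
                                 ∀ σ x → Reconstructible D r b π σ x → Accepted D r σ x
      Reconstructible⊆Accepted noFalseNegatives _ x (σ' , (valid , within , _) , mem≡ , _ , x∈) =
        subst (λ M → query r x M ≡ true) mem≡ (noFalseNegatives r σ' valid within x x∈)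

      Reconstructible-++ : b ∣ n → ∀ {σF σG τ ℓ x} → σF ≡ σG ++ τ →
        Conforms n b π σF → Conforms n b π σG → SelfContained τ →
        length (keys σG) ≡ ℓ * (n / b) →
        Reconstructible D r b π σG x → Reconstructible D r b π σF x
      Reconstructible-++ b∣n {σG = σG} {τ} {ℓ} {x} refl
          (_ , withinF , respectsF) (_ , withinG , respectsG) selfContained |σG|≡
          (σ' , conforms'@(_ , within' , respects') , mem'≡memG , |σ'|≡|σG| , x∈) =
          σ' ++ τ
        , Conforms-++-Avoids σG (sym |σ'|≡|σG|) avoidsG avoids' withinτ respectsτ conforms'
        , mem-++-cong σ' σG τ mem'≡memG
        , length-keys-++
        , subst (x ∈_) (sym (keys-++-Avoids σ' avoids')) (∈-++⁺ʳ (keys τ) x∈)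
        where
        m : ℕ
        m = n / b
        |σ'|≡ : length (keys σ') ≡ ℓ * m
        |σ'|≡ = trans |σ'|≡|σG| |σG|≡
        instance
          nonZero-m : NonZero m
          nonZero-m = nonZero-of-∈ ℓ m x∈ |σ'|≡
        open LowKeys π m ℓ (≤-reflexive (sym (m*[n/m]≡n b∣n)))
        withinτ : WithinCapacityFrom n (keys σG) τ
        withinτ = WithinCapacityFrom-++⁻ σG withinF
        respectsτ : RespectsFrom π m (keys σG) τ
        respectsτ = RespectsFrom-++⁻ π m σG respectsF
        lowG : All Low (keys σG)
        lowG = keys-All-Low withinG respectsG |σG|≡
        insertsHigh : ∀ {y} → ins y ∈ τ → High y
        insertsHigh = inserts-High lowG (≤-reflexive (sym |σG|≡)) selfContained [] withinτ respectsτ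
        avoidsG : Avoids (keys σG) [] τ
        avoidsG = avoids lowG selfContained [] insertsHigh
        avoids' : Avoids (keys σ') [] τ
        avoids' = avoids (keys-All-Low within' respects' |σ'|≡) selfContained [] insertsHigh
        length-keys-++ : length (keys (σ' ++ τ)) ≡ length (keys (σG ++ τ))
        length-keys-++ = begin
          length (keys (σ' ++ τ))    ≡⟨ cong length (keys-++-Avoids σ' avoids') ⟩
          length (keys τ ++ keys σ') ≡⟨ length-++-≡ (keys τ) |σ'|≡|σG| ⟩
          length (keys τ ++ keys σG) ≡⟨ cong length (keys-++-Avoids σG avoidsG) ⟨
          length (keys (σG ++ τ))    ∎
          where open ≡-Reasoning

lemma4 : ∀ {U : Set} (_≟_ : DecidableEquality U) {n : ℕ} (D : DynamicFilter U n) →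
    Keys.NoFalseNegatives _≟_ D →
    (r : DynamicFilter.Tape D) (b : ℕ) .{{_ : NonZero b}} → b ∣ n → (π : U → Fin b) →
    (σF σG : List (Op U)) →
    Keys.Conforms _≟_ n b π σF → Keys.Conforms _≟_ n b π σG →
    ((∀ x → x ∈ Keys.keys _≟_ σF → Keys.Reconstructible _≟_ D r b π σF x) ×
     (∀ x → Keys.Reconstructible _≟_ D r b π σF x → Keys.Accepted _≟_ D r σF x)) ×
    (∀ (τ : List (Op U)) → σF ≡ σG ++ τ → Keys.SelfContained _≟_ τ →
     ∀ (ℓ : ℕ) → length (Keys.keys _≟_ σG) ≡ ℓ * (n / b) →
     ∀ x → Keys.Reconstructible _≟_ D r b π σG x → Keys.Reconstructible _≟_ D r b π σF x)
lemma4 _≟_ D noFalseNegatives r b b∣n π σF σG conformsF conformsG =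
  ( keys⊆Reconstructible _≟_ D r b π conformsF
  , Reconstructible⊆Accepted _≟_ D r b π noFalseNegatives σF )
  , λ _ σF≡σG++τ selfContained ℓ |σG|≡ _ →
      Reconstructible-++ _≟_ D r b π b∣n {ℓ = ℓ}
        σF≡σG++τ conformsF conformsG selfContained |σG|≡
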